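{- For every integer $d\geq 2$ and every tree $T$ with $\ell$ leaves, the minimum number of subtrees of $T$, each with at most $d$ leaves, that cover $T$ is $\lceil \ell/d\rceil$.
   Context: A set of subtrees covers $T$ if every edge of $T$ lies in at least one of the subtrees. -}

module Defs where

open import Data.Nat using (ℕ; zero; suc; _+_; _∸_; _≤_; NonZero)
open import Data.Nat.DivMod using (_/_)
open import Data.Bool using (Bool; true; false; if_then_else_)
open import Data.Fin using (Fin)
open import Data.List using (List; []; _∷_; _++_; [_]; length; filter; map; sum; allFin)
open import Data.List.Relation.Unary.All using (All)
open import Data.List.Relation.Unary.Any using (Any)
open import Data.List.Relation.Unary.Unique.Propositional using (Unique)
open import Data.Product using (Σ; ∃; _×_)
open import Data.Unit using (⊤)
open import Relation.Binary.PropositionalEquality using (_≡_)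
open import Relation.Nullary using (¬_)
open import Data.Nat using (_≟_)

record Graph (n : ℕ) : Set where
  field
    adj    : Fin n → Fin n → Bool
    sym    : ∀ u v → adj u v ≡ adj v u
    irrefl : ∀ v → adj v v ≡ false
open Graph public

VSet : ℕ → Set
VSet n = Fin n → Bool

full : ∀ {n} → VSet n
full _ = true

module _ {n : ℕ} (G : Graph n) (S : VSet n) where

  data Walk : Fin n → Fin n → Set where
    here : ∀ {u} → S u ≡ true → Walk u u
    step : ∀ {u w v} → S u ≡ true → adj G u w ≡ true → Walk w v → Walk u v

  AdjChain : List (Fin n) → Set
  AdjChain [] = ⊤
  AdjChain (x ∷ []) = ⊤
  AdjChain (x ∷ y ∷ rest) = (adj G x y ≡ true) × AdjChain (y ∷ rest)

  IsCycle : List (Fin n) → Set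
  IsCycle [] = ⊥′
    where open import Data.Empty renaming (⊥ to ⊥′)
  IsCycle (v ∷ rest) =
    (3 ≤ length (v ∷ rest)) × Unique (v ∷ rest) × All (λ x → S x ≡ true) (v ∷ rest)
      × AdjChain ((v ∷ rest) ++ [ v ])

  IsTree : Set
  IsTree = (∃ λ v → S v ≡ true)
         × (∀ u v → S u ≡ true → S v ≡ true → Walk u v)
         × (∀ (xs : List (Fin n)) → ¬ IsCycle xs)

  degIn : Fin n → ℕ
  degIn v = length (filter (λ u → S u Data.Bool.∧ adj G v u ≟ᵇ true) (allFin n))
    where
      open import Data.Bool using (_∧_)
      open import Data.Bool.Properties using () renaming (_≟_ to _≟ᵇ_)

  leafCount : ℕ
  leafCount = length (filter (λ v → degIn v ≟ 1) (filter (λ v → S v ≟ᵇ true) (allFin n)))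
    where open import Data.Bool.Properties using () renaming (_≟_ to _≟ᵇ_)

Covers : ∀ {n} → Graph n → List (VSet n) → Set
Covers {n} G Ss = ∀ (u v : Fin n) → adj G u v ≡ true →
  Any (λ S → (S u ≡ true) × (S v ≡ true)) Ss

ceilDiv : ℕ → (d : ℕ) → .{{NonZero d}} → ℕ
ceilDiv ℓ d = (ℓ + (d ∸ 1)) / d

-- Lower bound: a leaf of G stays a leaf in every subtree containing its edge,
-- so the leaves of G inject into the leaves of the members of a cover, and a
-- cover by k subtrees gives ℓ ≤ k·d.
--
-- Upper bound: root G at a leaf and list all leaves in depth-first order
-- Λ = (root, λ₁, …, λ_{ℓ−1}).  With k = ⌈ℓ/d⌉, group j < k takes the entries
-- of Λ at positions j, j+k, …, j+(d−1)k, and the cover consists of the k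
-- subtrees spanned by the groups; each has at most d leaves, all in its
-- group.  The leaves below a non-root vertex w fill a block of consecutive
-- positions of Λ avoiding position 0; a residue-class argument gives a group
-- with a member inside and one outside the block, and the subtree spanned by
-- it contains the edge from w to its parent.
module Submission where

open import Defs renaming (sym to adj-symmetric)
open import Data.Nat using (ℕ; zero; suc; _+_; _*_; _∸_; _≤_; _<_; z≤n; s≤s; NonZero; _≟_; _<?_)
open import Data.Nat.Properties
open import Data.Nat.DivMod using (_/_; _%_; m≡m%n+[m/n]*n; m%n<n; m<n*o⇒m/o<n; m<n⇒m/n≡0)
open import Data.Bool using (Bool; true; false; _∧_)
import Data.Bool.Properties as Bool
open import Data.Fin using (Fin)
import Data.Fin.Properties as Fin
open import Data.List using (List; []; _∷_; _++_; [_]; length; filter; map; allFin; concatMap; downFrom)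
open import Data.List.Properties
  using (length-tabulate; length-++; length-map; length-downFrom; length-filter; concatMap-++; ++-assoc; ++-identityʳ)
open import Data.List.Relation.Unary.All using (All; []; _∷_)
import Data.List.Relation.Unary.All as All
import Data.List.Relation.Unary.All.Properties as All
open import Data.List.Relation.Unary.Any using (Any; here; there)
import Data.List.Relation.Unary.Any as Any
open import Data.List.Relation.Unary.Unique.Propositional using (Unique)
import Data.List.Relation.Unary.Unique.Propositional.Properties as Unique
open import Data.List.Relation.Unary.AllPairs using ([]; _∷_)
open import Data.List.Membership.Propositional using (_∈_; _∉_; find; lose)
open import Data.List.Membership.Propositional.Properties
  using ( ∈-filter⁺; ∈-filter⁻; ∈-allFin; ∈-++⁺ˡ; ∈-++⁺ʳ; ∈-map⁺; ∈-∃++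
        ; ∈-concatMap⁺; ∈-concatMap⁻; ∈-downFrom⁺; ∈-length)
open import Data.Product using (Σ; ∃; _×_; _,_; proj₁; proj₂; ∃-syntax)
open import Data.Sum using (_⊎_; inj₁; inj₂) renaming (map to ⊎-map)
open import Data.Empty using (⊥; ⊥-elim)
open import Data.Unit using (tt)
open import Relation.Binary.PropositionalEquality hiding ([_])
open import Relation.Nullary using (¬_; Dec; yes; no; does; ¬?)
open import Function using (id; _∘_)
import Data.List.Extrema.Nat as Extrema
open import Relation.Nullary.Decidable using (_×-dec_; dec-true; decidable-stable)
open import Data.Vec.Functional using (updateAt)
open import Data.Vec.Functional.Properties using (updateAt-updates; updateAt-minimal)

remove : ∀ {A : Set} {x : A} (ys : List A) → x ∈ ys → List A
remove (y ∷ ys) (here _)  = ys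
remove (y ∷ ys) (there p) = y ∷ remove ys p

length-remove : ∀ {A : Set} {x : A} (ys : List A) (p : x ∈ ys) → length ys ≡ suc (length (remove ys p))
length-remove (y ∷ ys) (here _)  = refl
length-remove (y ∷ ys) (there p) = cong suc (length-remove ys p)

∈-remove : ∀ {A : Set} {x z : A} (ys : List A) (p : x ∈ ys) → z ∈ ys → z ≢ x → z ∈ remove ys p
∈-remove (y ∷ ys) (here refl) (here refl) z≢x = ⊥-elim (z≢x refl)
∈-remove (y ∷ ys) (here refl) (there q)   z≢x = q
∈-remove (y ∷ ys) (there p)   (here refl) z≢x = here refl
∈-remove (y ∷ ys) (there p)   (there q)   z≢x = there (∈-remove ys p q z≢x)

unique⊆⇒length≤ : ∀ {A : Set} (xs ys : List A) → Unique xs → (∀ {z} → z ∈ xs → z ∈ ys) → length xs ≤ length ys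
unique⊆⇒length≤ []       ys _           _   = z≤n
unique⊆⇒length≤ (x ∷ xs) ys (x∉xs ∷ xs!) xs⊆ys = begin
  suc (length xs)               ≤⟨ s≤s (unique⊆⇒length≤ xs (remove ys x∈ys) xs! xs⊆ys-x) ⟩
  suc (length (remove ys x∈ys)) ≡⟨ length-remove ys x∈ys ⟨
  length ys                     ∎
  where
    open ≤-Reasoning
    x∈ys : x ∈ ys
    x∈ys = xs⊆ys (here refl)
    xs⊆ys-x : ∀ {z} → z ∈ xs → z ∈ remove ys x∈ys
    xs⊆ys-x z∈xs = ∈-remove ys x∈ys (xs⊆ys (there z∈xs)) (λ z≡x → All.lookup x∉xs z∈xs (sym z≡x))

unique-middle : ∀ {A : Set} (xs : List A) {w ys} → Unique (xs ++ w ∷ ys) → w ∉ xs × w ∉ ys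
unique-middle []       (w∉ys ∷ _) = (λ ()) , (λ w∈ys → All.lookup w∉ys w∈ys refl)
unique-middle (x ∷ xs) (x∉ ∷ xs!) =
  (λ { (here refl) → All.lookup x∉ (∈-++⁺ʳ xs (here refl)) refl ; (there w∈xs) → proj₁ (unique-middle xs xs!) w∈xs }) ,
  proj₂ (unique-middle xs xs!)

nonempty⇒member : ∀ {A : Set} (xs : List A) → 1 ≤ length xs → ∃[ x ] x ∈ xs
nonempty⇒member (x ∷ xs) _ = x , here refl

ceilDiv-least : ∀ ℓ k d .{{_ : NonZero d}} → ℓ ≤ k * d → ceilDiv ℓ d ≤ k
ceilDiv-least ℓ k (suc d') ℓ≤kd = ≤-pred (m<n*o⇒m/o<n ℓ+d'<[1+k]d)
  where
    open ≤-Reasoning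
    ℓ+d'<[1+k]d : ℓ + d' < suc k * suc d'
    ℓ+d'<[1+k]d = begin-strict
      ℓ + d'               ≤⟨ +-monoˡ-≤ d' ℓ≤kd ⟩
      k * suc d' + d'      <⟨ +-monoʳ-< (k * suc d') (n<1+n d') ⟩
      k * suc d' + suc d'  ≡⟨ +-comm (k * suc d') (suc d') ⟩
      suc k * suc d'       ∎

ceilDiv-covers : ∀ ℓ d .{{_ : NonZero d}} → ℓ ≤ ceilDiv ℓ d * d
ceilDiv-covers ℓ (suc d') = +-cancelʳ-≤ d' ℓ (q * suc d') ℓ+d'≤qd+d'
  where
    open ≤-Reasoning
    q : ℕ
    q = (ℓ + d') / suc d'
    ℓ+d'≤qd+d' : ℓ + d' ≤ q * suc d' + d'
    ℓ+d'≤qd+d' = begin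
      ℓ + d'                          ≡⟨ m≡m%n+[m/n]*n (ℓ + d') (suc d') ⟩
      (ℓ + d') % suc d' + q * suc d'  ≤⟨ +-monoˡ-≤ (q * suc d') (≤-pred (m%n<n (ℓ + d') (suc d'))) ⟩
      d' + q * suc d'                 ≡⟨ +-comm d' (q * suc d') ⟩
      q * suc d' + d'                 ∎

∧-elim : ∀ {a b : Bool} → (a ∧ b) ≡ true → a ≡ true × b ≡ true
∧-elim {true} {true} _ = refl , refl

∧-intro : ∀ {a b : Bool} → a ≡ true → b ≡ true → (a ∧ b) ≡ true
∧-intro refl refl = refl

true≢false : true ≢ false
true≢false ()

does⇒holds : ∀ {P : Set} (P? : Dec P) → does P? ≡ true → P
does⇒holds (yes p) _ = p

member? : ∀ {n} (S : VSet n) (x : Fin n) → Dec (S x ≡ true)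
member? S x = S x Bool.≟ true

members : ∀ {n} → VSet n → List (Fin n)
members {n} S = filter (member? S) (allFin n)

∈-members⁺ : ∀ {n} {S : VSet n} {x} → S x ≡ true → x ∈ members S
∈-members⁺ {S = S} {x} sx = ∈-filter⁺ (member? S) (∈-allFin x) sx

∈-members⁻ : ∀ {n} {S : VSet n} {x} → x ∈ members S → S x ≡ true
∈-members⁻ {n} {S} x∈ = proj₂ (∈-filter⁻ (member? S) {xs = allFin n} x∈)

members-unique : ∀ {n} (S : VSet n) → Unique (members S)
members-unique {n} S = Unique.filter⁺ (member? S) (Unique.allFin⁺ n)

module Degrees {n : ℕ} (G : Graph n) where

  neighbour? : (C : VSet n) (v u : Fin n) → Dec ((C u ∧ adj G v u) ≡ true)
  neighbour? C v u = (C u ∧ adj G v u) Bool.≟ true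

  neighbours : VSet n → Fin n → List (Fin n)
  neighbours C v = filter (neighbour? C v) (allFin n)

  ∈-neighbours⁺ : ∀ {C v u} → C u ≡ true → adj G v u ≡ true → u ∈ neighbours C v
  ∈-neighbours⁺ {C} {v} {u} cu vu = ∈-filter⁺ (neighbour? C v) (∈-allFin u) (∧-intro cu vu)

  ∈-neighbours⁻ : ∀ {C v u} → u ∈ neighbours C v → C u ≡ true × adj G v u ≡ true
  ∈-neighbours⁻ {C} {v} u∈ = ∧-elim (proj₂ (∈-filter⁻ (neighbour? C v) {xs = allFin n} u∈))

  neighbours-unique : ∀ C v → Unique (neighbours C v)
  neighbours-unique C v = Unique.filter⁺ (neighbour? C v) (Unique.allFin⁺ n)

  degree-mono : ∀ C D v → (∀ u → C u ≡ true → D u ≡ true) → degIn G C v ≤ degIn G D v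
  degree-mono C D v C⊆D = unique⊆⇒length≤ (neighbours C v) (neighbours D v) (neighbours-unique C v)
    (λ u∈ → let cu , vu = ∈-neighbours⁻ u∈ in ∈-neighbours⁺ (C⊆D _ cu) vu)

  degree-≥1 : ∀ C v u → C u ≡ true → adj G v u ≡ true → 1 ≤ degIn G C v
  degree-≥1 C v u cu vu = unique⊆⇒length≤ [ u ] (neighbours C v) ([] ∷ [])
    (λ { (here refl) → ∈-neighbours⁺ cu vu })

  degree-≥2 : ∀ C v u₁ u₂ → u₁ ≢ u₂ → C u₁ ≡ true → adj G v u₁ ≡ true → C u₂ ≡ true → adj G v u₂ ≡ true →
    2 ≤ degIn G C v
  degree-≥2 C v u₁ u₂ u₁≢u₂ cu₁ vu₁ cu₂ vu₂ =
    unique⊆⇒length≤ (u₁ ∷ u₂ ∷ []) (neighbours C v) ((u₁≢u₂ ∷ []) ∷ [] ∷ [])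
      (λ { (here refl) → ∈-neighbours⁺ cu₁ vu₁ ; (there (here refl)) → ∈-neighbours⁺ cu₂ vu₂ })

  degree-≤1 : ∀ C v u → (∀ w → C w ≡ true → adj G v w ≡ true → w ≡ u) → degIn G C v ≤ 1
  degree-≤1 C v u only-u = unique⊆⇒length≤ (neighbours C v) [ u ] (neighbours-unique C v)
    (λ w∈ → let cw , vw = ∈-neighbours⁻ w∈ in here (only-u _ cw vw))

  degree≥1⇒neighbour : ∀ C v → 1 ≤ degIn G C v → ∃[ u ] (C u ≡ true × adj G v u ≡ true)
  degree≥1⇒neighbour C v deg≥1 =
    let u , u∈ = nonempty⇒member (neighbours C v) deg≥1 in u , ∈-neighbours⁻ u∈

  isLeaf? : (C : VSet n) (v : Fin n) → Dec (degIn G C v ≡ 1)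
  isLeaf? C v = degIn G C v ≟ 1

  leaves : VSet n → List (Fin n)
  leaves C = filter (isLeaf? C) (members C)

  leaves-unique : ∀ C → Unique (leaves C)
  leaves-unique C = Unique.filter⁺ (isLeaf? C) (members-unique C)

  ∈-leaves⁻ : ∀ C {x} → x ∈ leaves C → C x ≡ true × degIn G C x ≡ 1
  ∈-leaves⁻ C x∈ =
    let x∈C , deg≡1 = ∈-filter⁻ (isLeaf? C) {xs = members C} x∈ in ∈-members⁻ x∈C , deg≡1

  ∈-leaves⁺ : ∀ C {x} → C x ≡ true → degIn G C x ≡ 1 → x ∈ leaves C
  ∈-leaves⁺ C cx deg≡1 = ∈-filter⁺ (isLeaf? C) (∈-members⁺ cx) deg≡1

  -- A leaf x of G stays a leaf in every G[S] containing one of its edges: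
  -- its degree there is at least 1 and at most its degree in G.
  leaf-stays-leaf : ∀ S {x y} → degIn G full x ≡ 1 → S x ≡ true → S y ≡ true → adj G x y ≡ true → x ∈ leaves S
  leaf-stays-leaf S {x} {y} deg≡1 sx sy xy = ∈-leaves⁺ S sx (≤-antisym
    (subst (degIn G S x ≤_) deg≡1 (degree-mono S full x (λ _ _ → refl)))
    (degree-≥1 S x y sy xy))

  leaf∈cover-leaves : ∀ (Ss : List (VSet n)) → Covers G Ss → ∀ {x} → x ∈ leaves full → x ∈ concatMap leaves Ss
  leaf∈cover-leaves Ss cover {x} x∈
    with deg≡1 ← proj₂ (∈-leaves⁻ full x∈)
    with y , _ , xy ← degree≥1⇒neighbour full x (≤-reflexive (sym deg≡1))
    = ∈-concatMap⁺ leaves (Any.map (λ (sx , sy) → leaf-stays-leaf _ deg≡1 sx sy xy) (cover x y xy))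

  length-concatMap-leaves : ∀ d (Ss : List (VSet n)) → All (λ S → leafCount G S ≤ d) Ss →
    length (concatMap leaves Ss) ≤ length Ss * d
  length-concatMap-leaves d []       []         = z≤n
  length-concatMap-leaves d (S ∷ Ss) (ℓS≤d ∷ h) = begin
    length (leaves S ++ concatMap leaves Ss)      ≡⟨ length-++ (leaves S) ⟩
    leafCount G S + length (concatMap leaves Ss)  ≤⟨ +-mono-≤ ℓS≤d (length-concatMap-leaves d Ss h) ⟩
    d + length Ss * d                             ∎
    where open ≤-Reasoning

  leafCount≤cover-size*d : ∀ d (Ss : List (VSet n)) → Covers G Ss → All (λ S → leafCount G S ≤ d) Ss →
    leafCount G full ≤ length Ss * d
  leafCount≤cover-size*d d Ss cover small = ≤-trans
    (unique⊆⇒length≤ (leaves full) (concatMap leaves Ss) (leaves-unique full) (leaf∈cover-leaves Ss cover))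
    (length-concatMap-leaves d Ss small)

module Walks {n : ℕ} (G : Graph n) where

  adj-sym : ∀ u v → adj G u v ≡ true → adj G v u ≡ true
  adj-sym u v uv = trans (adj-symmetric G v u) uv

  no-loop : ∀ {a b} → a ≡ b → adj G a b ≡ true → ⊥
  no-loop {a} refl aa = true≢false (trans (sym aa) (irrefl G a))

  walk-end : ∀ {S a b} → Walk G S a b → S b ≡ true
  walk-end (here sb)     = sb
  walk-end (step _ _ w)  = walk-end w

  walk-++ : ∀ {S a b c} → Walk G S a b → Walk G S b c → Walk G S a c
  walk-++ (here _)       w' = w'
  walk-++ (step sa ab w) w' = step sa ab (walk-++ w w')

  walk-reverse : ∀ {S a b} → Walk G S a b → Walk G S b a
  walk-reverse (here sa) = here sa
  walk-reverse {S} {a} {b} (step {w = w} sa aw w→b) =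
    walk-++ b→w (step (walk-end b→w) (adj-sym a w aw) (here sa))
    where
      b→w : Walk G S b w
      b→w = walk-reverse w→b

  data Path : Fin n → Fin n → List (Fin n) → Set where
    [_]ᵖ : ∀ a → Path a a [ a ]
    _∷ᵖ_ : ∀ {a w b xs} → adj G a w ≡ true → Path w b xs → Path a b (a ∷ xs)

  SimplePath : VSet n → Fin n → Fin n → Set
  SimplePath S a b = Σ (List (Fin n)) λ xs → Path a b xs × Unique xs × All (λ x → S x ≡ true) xs

  suffix : ∀ {S w b xs} → Path w b xs → Unique xs → All (λ x → S x ≡ true) xs →
    ∀ {a} → a ∈ xs → SimplePath S a b
  suffix p@([ _ ]ᵖ)   xs! inS (here refl) = _ , p , xs! , inS
  suffix p@(_ ∷ᵖ _)   xs! inS (here refl) = _ , p , xs! , inS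
  suffix (_ ∷ᵖ p) (_ ∷ xs!) (_ ∷ inS) (there a∈) = suffix p xs! inS a∈

  -- Cutting out closed detours turns any walk into a simple path.
  walk⇒simplePath : ∀ {S a b} → Walk G S a b → SimplePath S a b
  walk⇒simplePath (here sa) = _ , [ _ ]ᵖ , [] ∷ [] , sa ∷ []
  walk⇒simplePath {a = a} (step sa aw w→b) with walk⇒simplePath w→b
  ... | xs , p , xs! , inS with Any.any? (Fin._≟ a) xs
  ...   | yes a∈xs = suffix p xs! inS (Any.map sym a∈xs)
  ...   | no  a∉xs = a ∷ xs , aw ∷ᵖ p , All.tabulate (λ z∈ z≡a → a∉xs (Any.map (λ { refl → sym z≡a }) z∈)) ∷ xs!
                   , sa ∷ inS

  path-adjChain : ∀ {a b xs v} → Path a b xs → adj G b v ≡ true → AdjChain G full (xs ++ [ v ])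
  path-adjChain [ _ ]ᵖ             bv = bv , tt
  path-adjChain (aw ∷ᵖ [ _ ]ᵖ)     bv = aw , bv , tt
  path-adjChain (aw ∷ᵖ p@(_ ∷ᵖ _)) bv = aw , path-adjChain p bv

  path-length : ∀ {a b xs} → Path a b xs → a ≢ b → 2 ≤ length xs
  path-length [ _ ]ᵖ              a≢b = ⊥-elim (a≢b refl)
  path-length (_ ∷ᵖ [ _ ]ᵖ)      _   = s≤s (s≤s z≤n)
  path-length (_ ∷ᵖ (_ ∷ᵖ _))    _   = s≤s (s≤s z≤n)

  cycle-through : ∀ {S v u₁ u₂} → S v ≡ false → adj G v u₁ ≡ true → adj G v u₂ ≡ true → u₁ ≢ u₂ →
    Walk G S u₁ u₂ → Σ (List (Fin n)) (IsCycle G full)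
  cycle-through {S} {v} {u₁} {u₂} sv vu₁ vu₂ u₁≢u₂ u₁→u₂ with walk⇒simplePath u₁→u₂
  ... | xs , p , xs! , inS =
    v ∷ xs , s≤s (path-length p u₁≢u₂) , v∉xs ∷ xs! , All.tabulate (λ _ → refl) , closing p
    where
      v∉xs : All (v ≢_) xs
      v∉xs = All.tabulate (λ z∈ v≡z → true≢false (trans (sym (All.lookup inS z∈)) (trans (cong S (sym v≡z)) sv)))
      closing : ∀ {xs} → Path u₁ u₂ xs → AdjChain G full ((v ∷ xs) ++ [ v ])
      closing [ _ ]ᵖ       = vu₁ , adj-sym v u₁ vu₂ , tt
      closing q@(_ ∷ᵖ _)   = vu₁ , path-adjChain q (adj-sym v u₂ vu₂)

  cycle-in-full : ∀ {S} xs → IsCycle G S xs → IsCycle G full xs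
  cycle-in-full {S} (v ∷ rest) (len , xs! , _ , chain) = len , xs! , All.tabulate (λ _ → refl) , widen ((v ∷ rest) ++ [ v ]) chain
    where
      widen : ∀ ys → AdjChain G S ys → AdjChain G full ys
      widen []           _        = tt
      widen (x ∷ [])     _        = tt
      widen (x ∷ y ∷ ys) (xy , c) = xy , widen (y ∷ ys) c

record Rooting {n : ℕ} (G : Graph n) (r : Fin n) (S : VSet n) : Set where
  field
    par         : Fin n → Fin n
    depth       : Fin n → ℕ
    root∈       : S r ≡ true
    par∈        : ∀ x → S x ≡ true → x ≢ r → S (par x) ≡ true
    depth-par   : ∀ x → S x ≡ true → x ≢ r → depth (par x) < depth x
    adj-par     : ∀ x → S x ≡ true → x ≢ r → adj G (par x) x ≡ true
    edges       : ∀ u v → S u ≡ true → S v ≡ true → adj G u v ≡ true → (v ≢ r × par v ≡ u) ⊎ (u ≢ r × par u ≡ v)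
    bound       : ℕ
    depth<bound : ∀ x → S x ≡ true → depth x < bound

-- Every tree has a rooting at any vertex: start from the root alone and keep
-- attaching a vertex across an edge that leaves the current set.
module RootingConstruction {n : ℕ} (G : Graph n) (tree : IsTree G full) where
  open Walks G

  acyclic : ∀ {xs} → ¬ IsCycle G full xs
  acyclic = proj₂ (proj₂ tree) _

  module _ {r : Fin n} {S : VSet n} (R : Rooting G r S) where
    open Rooting R

    walk-to-root : ∀ f x → depth x < f → S x ≡ true → Walk G S x r
    walk-to-root (suc f) x dx<f sx with x Fin.≟ r
    ... | yes refl = here sx
    ... | no  x≢r  = step sx (adj-sym (par x) x (adj-par x sx x≢r))
                       (walk-to-root f (par x) (≤-trans (depth-par x sx x≢r) (≤-pred dx<f)) (par∈ x sx x≢r))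

    connected : ∀ x y → S x ≡ true → S y ≡ true → Walk G S x y
    connected x y sx sy =
      walk-++ (walk-to-root _ x (depth<bound x sx) sx) (walk-reverse (walk-to-root _ y (depth<bound y sy) sy))

    module Attach (u v : Fin n) (su : S u ≡ true) (sv : S v ≡ false) (uv : adj G u v ≡ true) where
      S′ : VSet n
      S′ = updateAt S v (λ _ → true)

      par′ : Fin n → Fin n
      par′ = updateAt par v (λ _ → u)

      depth′ : Fin n → ℕ
      depth′ = updateAt depth v (λ _ → bound)

      old≢v : ∀ {x} → S x ≡ true → x ≢ v
      old≢v sx refl = true≢false (trans (sym sx) sv)

      v≢r : v ≢ r
      v≢r v≡r = old≢v root∈ (sym v≡r)

      old∈ : ∀ {x} → S x ≡ true → S′ x ≡ true
      old∈ {x} sx = trans (updateAt-minimal x v S (old≢v sx)) sx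

      new∈ : S′ v ≡ true
      new∈ = updateAt-updates v S

      new-or-old : ∀ {x} → S′ x ≡ true → x ≡ v ⊎ S x ≡ true
      new-or-old {x} s′x with x Fin.≟ v
      ... | yes x≡v = inj₁ x≡v
      ... | no  x≢v = inj₂ (trans (sym (updateAt-minimal x v S x≢v)) s′x)

      size-grows : length (members S) < length (members S′)
      size-grows = unique⊆⇒length≤ (v ∷ members S) (members S′)
        (All.tabulate (λ x∈ v≡x → old≢v (∈-members⁻ x∈) (sym v≡x)) ∷ members-unique S)
        (λ { (here refl) → ∈-members⁺ new∈ ; (there x∈) → ∈-members⁺ (old∈ (∈-members⁻ x∈)) })

      -- As G has no cycle, u is the only neighbour of v inside S.
      only-neighbour : ∀ w → S w ≡ true → adj G v w ≡ true → w ≡ u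
      only-neighbour w sw vw with w Fin.≟ u
      ... | yes w≡u = w≡u
      ... | no  w≢u = ⊥-elim (acyclic (proj₂ (cycle-through sv (adj-sym u v uv) vw (w≢u ∘ sym) (connected u w su sw))))

      par′∈ : ∀ x → x ≡ v ⊎ S x ≡ true → x ≢ r → S′ (par′ x) ≡ true
      par′∈ x (inj₁ refl) _   = subst (λ p → S′ p ≡ true) (sym (updateAt-updates x par)) (old∈ su)
      par′∈ x (inj₂ sx)   x≢r =
        subst (λ p → S′ p ≡ true) (sym (updateAt-minimal x v par (old≢v sx))) (old∈ (par∈ x sx x≢r))

      depth′-par′ : ∀ x → x ≡ v ⊎ S x ≡ true → x ≢ r → depth′ (par′ x) < depth′ x
      depth′-par′ x (inj₁ refl) _
        rewrite updateAt-updates x {λ _ → u} par | updateAt-updates x {λ _ → bound} depth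
              | updateAt-minimal u x {λ _ → bound} depth (old≢v su) = depth<bound u su
      depth′-par′ x (inj₂ sx) x≢r
        rewrite updateAt-minimal x v {λ _ → u} par (old≢v sx) | updateAt-minimal x v {λ _ → bound} depth (old≢v sx)
              | updateAt-minimal (par x) v {λ _ → bound} depth (old≢v (par∈ x sx x≢r)) = depth-par x sx x≢r

      adj-par′ : ∀ x → x ≡ v ⊎ S x ≡ true → x ≢ r → adj G (par′ x) x ≡ true
      adj-par′ x (inj₁ refl) _   rewrite updateAt-updates x {λ _ → u} par = uv
      adj-par′ x (inj₂ sx)   x≢r rewrite updateAt-minimal x v {λ _ → u} par (old≢v sx) = adj-par x sx x≢r

      depth′<bound : ∀ x → x ≡ v ⊎ S x ≡ true → depth′ x < suc bound
      depth′<bound x (inj₁ refl) rewrite updateAt-updates x {λ _ → bound} depth = ≤-refl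
      depth′<bound x (inj₂ sx)   rewrite updateAt-minimal x v {λ _ → bound} depth (old≢v sx) = m≤n⇒m≤1+n (depth<bound x sx)

      edges′ : ∀ a b → a ≡ v ⊎ S a ≡ true → b ≡ v ⊎ S b ≡ true → adj G a b ≡ true →
        (b ≢ r × par′ b ≡ a) ⊎ (a ≢ r × par′ a ≡ b)
      edges′ a b (inj₁ refl) (inj₁ refl) ab = ⊥-elim (no-loop refl ab)
      edges′ a b (inj₁ refl) (inj₂ sb)   ab rewrite updateAt-updates a {λ _ → u} par =
        inj₂ (v≢r , sym (only-neighbour b sb ab))
      edges′ a b (inj₂ sa)   (inj₁ refl) ab rewrite updateAt-updates b {λ _ → u} par =
        inj₁ (v≢r , sym (only-neighbour a sa (adj-sym a b ab)))
      edges′ a b (inj₂ sa)   (inj₂ sb)   ab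
        rewrite updateAt-minimal a v {λ _ → u} par (old≢v sa) | updateAt-minimal b v {λ _ → u} par (old≢v sb) = edges a b sa sb ab

      attached : Rooting G r S′
      attached = record
        { par = par′ ; depth = depth′ ; root∈ = old∈ root∈
        ; par∈ = λ x s′x → par′∈ x (new-or-old s′x)
        ; depth-par = λ x s′x → depth′-par′ x (new-or-old s′x)
        ; adj-par = λ x s′x → adj-par′ x (new-or-old s′x)
        ; edges = λ a b s′a s′b → edges′ a b (new-or-old s′a) (new-or-old s′b)
        ; bound = suc bound
        ; depth<bound = λ x s′x → depth′<bound x (new-or-old s′x) }

  LeavingEdge : VSet n → Set
  LeavingEdge S = ∃[ u ] ∃[ v ] (S u ≡ true × S v ≡ false × adj G u v ≡ true)

  leaving-edge? : ∀ S → Dec (LeavingEdge S)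
  leaving-edge? S = Fin.any? (λ u → Fin.any? (λ v → (S u Bool.≟ true) ×-dec (S v Bool.≟ false) ×-dec (adj G u v Bool.≟ true)))

  -- As G is connected, a nonempty vertex set left by no edge contains every vertex.
  closed⇒full : ∀ {r} S → S r ≡ true → ¬ LeavingEdge S → ∀ x → S x ≡ true
  closed⇒full {r} S sr closed x = along (proj₁ (proj₂ tree) r x refl refl) sr
    where
      along : ∀ {a b} → Walk G full a b → S a ≡ true → S b ≡ true
      along (here _) sa = sa
      along (step {u = a} {w = w} _ aw w→b) sa with S w Bool.≟ true
      ... | yes sw = along w→b sw
      ... | no ¬sw = ⊥-elim (closed (a , w , sa , Bool.¬-not ¬sw , aw))

  size≤n : ∀ S → length (members S) ≤ n
  size≤n S = ≤-trans (length-filter (member? S) (allFin n)) (≤-reflexive (length-tabulate id))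

  -- Attach vertices until no edge leaves the set; the fuel f, with
  -- n ≤ f + |S|, bounds the number of attachments since |S| ≤ n.
  grow : ∀ {r} f S → Rooting G r S → n ≤ f + length (members S) →
    Σ (VSet n) λ S′ → Rooting G r S′ × (∀ x → S′ x ≡ true)
  grow f S R n≤f+|S| with leaving-edge? S
  ... | no closed = S , R , closed⇒full S (Rooting.root∈ R) closed
  ... | yes (u , v , su , sv , uv) with f
  ...   | zero   = ⊥-elim (<-irrefl refl (≤-<-trans n≤f+|S| (<-≤-trans size-grows (size≤n S′))))
    where open Attach R u v su sv uv
  ...   | suc f′ = grow f′ S′ attached
                     (≤-trans n≤f+|S| (subst (_≤ f′ + length (members S′)) (+-suc f′ _) (+-monoʳ-≤ f′ size-grows)))
    where open Attach R u v su sv uv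

  singleton : Fin n → VSet n
  singleton r x = does (x Fin.≟ r)

  singleton-rooting : ∀ r → Rooting G r (singleton r)
  singleton-rooting r = record
    { par = id ; depth = λ _ → 0 ; root∈ = dec-true (r Fin.≟ r) refl
    ; par∈ = λ x sx x≢r → ⊥-elim (x≢r (is-r sx))
    ; depth-par = λ x sx x≢r → ⊥-elim (x≢r (is-r sx))
    ; adj-par = λ x sx x≢r → ⊥-elim (x≢r (is-r sx))
    ; edges = λ a b sa sb ab → ⊥-elim (no-loop (trans (is-r sa) (sym (is-r sb))) ab)
    ; bound = 1 ; depth<bound = λ _ _ → s≤s z≤n }
    where
      is-r : ∀ {x} → singleton r x ≡ true → x ≡ r
      is-r {x} = does⇒holds (x Fin.≟ r)

  rooting : ∀ r → Σ (VSet n) λ S → Rooting G r S × (∀ x → S x ≡ true)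
  rooting r = grow n (singleton r) (singleton-rooting r) (m≤m+n n _)

record RootedTree {n : ℕ} (G : Graph n) : Set where
  field
    root        : Fin n
    par         : Fin n → Fin n
    depth       : Fin n → ℕ
    depth-par   : ∀ x → x ≢ root → depth (par x) < depth x
    adj-par     : ∀ x → x ≢ root → adj G (par x) x ≡ true
    edges       : ∀ u v → adj G u v ≡ true → (v ≢ root × par v ≡ u) ⊎ (u ≢ root × par u ≡ v)
    bound       : ℕ
    depth<bound : ∀ x → depth x < bound

rootedAt : ∀ {n} (G : Graph n) → IsTree G full → Fin n → RootedTree G
rootedAt G tree r with RootingConstruction.rooting G tree r
... | S , R , all∈S = record
  { root = r ; par = par ; depth = depth
  ; depth-par = λ x → depth-par x (all∈S x)
  ; adj-par = λ x → adj-par x (all∈S x)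
  ; edges = λ u v → edges u v (all∈S u) (all∈S v)
  ; bound = bound ; depth<bound = λ x → depth<bound x (all∈S x) }
  where open Rooting R

argmax-over : ∀ {n} {P : Fin n → Set} (P? : ∀ x → Dec (P x)) (f : Fin n → ℕ) → ∃ P →
  ∃[ x ] (P x × ∀ y → P y → f y ≤ f x)
argmax-over {n} P? f (x₀ , px₀) =
  best , Extrema.argmax-all f px₀ (All.tabulate (λ y∈ → proj₂ (∈-filter⁻ P? {xs = allFin n} y∈))) ,
  λ y py → Extrema.v≤f[argmax]⁺ x₀ candidates (inj₂ (lose (∈-filter⁺ P? (∈-allFin y) py) ≤-refl))
  where
    candidates : List (Fin _)
    candidates = filter P? (allFin n)
    best : Fin _
    best = Extrema.argmax f x₀ candidates

module Ancestry {n : ℕ} {G : Graph n} (T : RootedTree G) where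
  open RootedTree T
  open Walks G

  -- w ≼ x: w lies on the way from x up to the root.
  data _≼_ : Fin n → Fin n → Set where
    ≼-refl : ∀ {x} → x ≼ x
    ≼-par  : ∀ {w x} → x ≢ root → w ≼ par x → w ≼ x

  infix 4 _≼_

  depth-mono : ∀ {w x} → w ≼ x → depth w ≤ depth x
  depth-mono ≼-refl             = ≤-refl
  depth-mono (≼-par {x = x} x≢r w≼px) = ≤-trans (depth-mono w≼px) (<⇒≤ (depth-par x x≢r))

  ≼-par⁻ : ∀ {w x} → w ≼ x → w ≢ x → x ≢ root × w ≼ par x
  ≼-par⁻ ≼-refl            w≢x = ⊥-elim (w≢x refl)
  ≼-par⁻ (≼-par x≢r w≼px) _   = x≢r , w≼px

  ≼-root : ∀ {w} → w ≼ root → w ≡ root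
  ≼-root {w} w≼r with w Fin.≟ root
  ... | yes w≡r = w≡r
  ... | no  w≢r = ⊥-elim (proj₁ (≼-par⁻ w≼r w≢r) refl)

  ≼-trans : ∀ {a b c} → a ≼ b → b ≼ c → a ≼ c
  ≼-trans a≼b ≼-refl             = a≼b
  ≼-trans a≼b (≼-par c≢r b≼pc)   = ≼-par c≢r (≼-trans a≼b b≼pc)

  par≼ : ∀ {c} → c ≢ root → par c ≼ c
  par≼ c≢r = ≼-par c≢r ≼-refl

  par⋠ : ∀ {c} → c ≢ root → ¬ (c ≼ par c)
  par⋠ {c} c≢r c≼pc = <-irrefl refl (≤-<-trans (depth-mono c≼pc) (depth-par c c≢r))

  _≼?_ : ∀ w x → Dec (w ≼ x)
  w ≼? x = go bound x (depth<bound x)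
    where
      go : ∀ f x → depth x < f → Dec (w ≼ x)
      go (suc f) x dx<f with w Fin.≟ x
      ... | yes refl = yes ≼-refl
      ... | no  w≢x with x Fin.≟ root
      ...   | yes refl = no (λ w≼r → w≢x (≼-root w≼r))
      ...   | no  x≢r with go f (par x) (≤-trans (depth-par x x≢r) (≤-pred dx<f))
      ...     | yes w≼px = yes (≼-par x≢r w≼px)
      ...     | no  w⋠px = no (λ w≼x → w⋠px (proj₂ (≼-par⁻ w≼x w≢x)))

  root≼ : ∀ x → root ≼ x
  root≼ x = go bound x (depth<bound x)
    where
      go : ∀ f x → depth x < f → root ≼ x
      go (suc f) x dx<f with x Fin.≟ root
      ... | yes refl = ≼-refl
      ... | no  x≢r  = ≼-par x≢r (go f (par x) (≤-trans (depth-par x x≢r) (≤-pred dx<f)))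

  ≼-chain : ∀ {w c a} → w ≼ a → c ≼ a → w ≼ c ⊎ c ≼ w
  ≼-chain ≼-refl c≼a = inj₂ c≼a
  ≼-chain {c = c} {a} w≼a@(≼-par _ w≼pa) c≼a with c Fin.≟ a
  ... | yes refl = inj₁ w≼a
  ... | no  c≢a  = ≼-chain w≼pa (proj₂ (≼-par⁻ c≼a c≢a))

  siblings-disjoint : ∀ {c w a} → c ≢ root → w ≢ root → par c ≡ par w → c ≼ a → w ≼ a → c ≡ w
  siblings-disjoint {c} {w} c≢r w≢r pc≡pw c≼a w≼a with c Fin.≟ w
  ... | yes c≡w = c≡w
  ... | no  c≢w with ≼-chain c≼a w≼a
  ...   | inj₁ c≼w = ⊥-elim (par⋠ c≢r (subst (c ≼_) (sym pc≡pw) (proj₂ (≼-par⁻ c≼w c≢w))))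
  ...   | inj₂ w≼c = ⊥-elim (par⋠ w≢r (subst (w ≼_) pc≡pw (proj₂ (≼-par⁻ w≼c (λ w≡c → c≢w (sym w≡c))))))

  child-toward : ∀ {w a} → w ≼ a → w ≢ a → ∃[ c ] (c ≢ root × par c ≡ w × c ≼ a)
  child-toward ≼-refl w≢a = ⊥-elim (w≢a refl)
  child-toward {w} (≼-par {x = a} a≢r w≼pa) w≢a with w Fin.≟ par a
  ... | yes refl = a , a≢r , refl , ≼-refl
  ... | no  w≢pa with child-toward w≼pa w≢pa
  ...   | c , c≢r , pc≡w , c≼pa = c , c≢r , pc≡w , ≼-par a≢r c≼pa

  walk-up : ∀ {S t x} → t ≼ x → (∀ y → t ≼ y → y ≼ x → S y ≡ true) → Walk G S x t
  walk-up {x = x} ≼-refl            inS = here (inS x ≼-refl ≼-refl)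
  walk-up {x = x} (≼-par x≢r t≼px)  inS =
    step (inS x (≼-par x≢r t≼px) ≼-refl) (adj-sym (par x) x (adj-par x x≢r))
      (walk-up t≼px (λ y t≼y y≼px → inS y t≼y (≼-trans y≼px (par≼ x≢r))))

  Childless : Fin n → Set
  Childless x = ∀ c → c ≢ root → par c ≢ x

  open Degrees G

  -- A childless vertex other than the root is a leaf: its only neighbour is its parent.
  childless-leaf : ∀ x → x ≢ root → Childless x → degIn G full x ≡ 1
  childless-leaf x x≢r childless = ≤-antisym
    (degree-≤1 full x (par x) only-parent)
    (degree-≥1 full x (par x) refl (adj-sym (par x) x (adj-par x x≢r)))
    where
      only-parent : ∀ y → full y ≡ true → adj G x y ≡ true → y ≡ par x
      only-parent y _ xy with edges x y xy
      ... | inj₁ (y≢r , py≡x) = ⊥-elim (childless y y≢r py≡x)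
      ... | inj₂ (_ , px≡y)   = sym px≡y

  -- A deepest vertex is childless; it is not the root when another vertex exists.
  childless-exists : ∀ {x₀} → x₀ ≢ root → ∃[ x ] (x ≢ root × Childless x)
  childless-exists {x₀} x₀≢r with argmax-over (λ x → ¬? (x Fin.≟ root)) depth (x₀ , x₀≢r)
  ... | x , x≢r , deepest = x , x≢r , λ c c≢r pc≡x → <-irrefl refl
          (≤-<-trans (deepest c c≢r) (subst (λ p → depth p < depth c) pc≡x (depth-par c c≢r)))

-- The subtree spanned by a nonempty vertex set A of a rooted tree: the
-- vertices below the deepest common ancestor t of A and above some member of A.
module Spanning {n : ℕ} {G : Graph n} (tree : IsTree G full) (T : RootedTree G)
                (A : List (Fin n)) {a₀ : Fin n} (a₀∈A : a₀ ∈ A) where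
  open RootedTree T
  open Ancestry T
  open Walks G
  open Degrees G
  open import Data.List.Membership.DecPropositional (Fin._≟_ {n}) using (_∈?_)

  deepest-common-ancestor : ∃[ t ] (All (t ≼_) A × ∀ y → All (y ≼_) A → depth y ≤ depth t)
  deepest-common-ancestor =
    argmax-over (λ x → All.all? (x ≼?_) A) depth (root , All.tabulate (λ {a} _ → root≼ a))

  t : Fin n
  t = proj₁ deepest-common-ancestor

  t≼A : All (t ≼_) A
  t≼A = proj₁ (proj₂ deepest-common-ancestor)

  t-deepest : ∀ y → All (y ≼_) A → depth y ≤ depth t
  t-deepest = proj₂ (proj₂ deepest-common-ancestor)

  span? : ∀ x → Dec ((t ≼ x) × Any (x ≼_) A)
  span? x = (t ≼? x) ×-dec Any.any? (x ≼?_) A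

  Span : VSet n
  Span x = does (span? x)

  Span⁺ : ∀ {x} → t ≼ x → Any (x ≼_) A → Span x ≡ true
  Span⁺ {x} t≼x x≼A = dec-true (span? x) (t≼x , x≼A)

  Span⁻ : ∀ {x} → Span x ≡ true → (t ≼ x) × Any (x ≼_) A
  Span⁻ {x} sx = does⇒holds (span? x) sx

  -- Every vertex of the span reaches t inside the span, so it is connected;
  -- it is acyclic as G is.
  span-tree : IsTree G Span
  span-tree = (t , Span⁺ ≼-refl (lose a₀∈A (All.lookup t≼A a₀∈A))) , connected ,
              (λ xs cycle → proj₂ (proj₂ tree) xs (cycle-in-full xs cycle))
    where
      to-t : ∀ x → Span x ≡ true → Walk G Span x t
      to-t x sx with Span⁻ sx
      ... | t≼x , x≼A = walk-up t≼x (λ y t≼y y≼x → Span⁺ t≼y (Any.map (≼-trans y≼x) x≼A))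
      connected : ∀ x y → Span x ≡ true → Span y ≡ true → Walk G Span x y
      connected x y sx sy = walk-++ (to-t x sx) (walk-reverse (to-t y sy))

  child∈Span : ∀ {x c a} → Span x ≡ true → c ≢ root → par c ≡ x → a ∈ A → c ≼ a → Span c ≡ true
  child∈Span sx c≢r refl a∈A c≼a = Span⁺ (≼-trans (proj₁ (Span⁻ sx)) (par≼ c≢r)) (lose a∈A c≼a)

  -- A vertex x ∉ A of the span other than t has two neighbours in the span:
  -- its parent, and its child toward a member of A below x.
  inner-degree≥2 : ∀ {x a} → Span x ≡ true → x ≢ t → a ∈ A → x ≼ a → x ≢ a → 2 ≤ degIn G Span x
  inner-degree≥2 {x} {a} sx x≢t a∈A x≼a x≢a with child-toward x≼a x≢a
  ... | c , c≢r , refl , c≼a =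
    degree-≥2 Span x c (par x) c≢px (child∈Span sx c≢r refl a∈A c≼a) (adj-par c c≢r)
      (Span⁺ (proj₂ t≺x) (lose a∈A (≼-trans (par≼ (proj₁ t≺x)) x≼a))) (adj-sym (par x) x (adj-par x (proj₁ t≺x)))
    where
      t≺x : x ≢ root × t ≼ par x
      t≺x = ≼-par⁻ (proj₁ (Span⁻ sx)) (λ t≡x → x≢t (sym t≡x))
      c≢px : c ≢ par x
      c≢px c≡px = <-irrefl refl (≤-<-trans (depth-mono (subst (_≼ x) (sym c≡px) (par≼ (proj₁ t≺x)))) (depth-par c c≢r))

  -- A child of t is not a common ancestor of A, being deeper than t.
  child-of-t-misses : ∀ {c} → c ≢ root → par c ≡ t → ∃[ b ] (b ∈ A × ¬ (c ≼ b))
  child-of-t-misses {c} c≢r pc≡t = find (All.¬All⇒Any¬ (c ≼?_) A λ c≼A →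
    <-irrefl refl (≤-<-trans (t-deepest c c≼A) (subst (λ p → depth p < depth c) pc≡t (depth-par c c≢r))))

  -- If t ∉ A, its child toward a member a of A is not a common ancestor of A
  -- (being deeper than t), so another child of t leads to another member b.
  top-degree≥2 : ∀ {a} → t ∉ A → a ∈ A → t ≼ a → 2 ≤ degIn G Span t
  top-degree≥2 {a} t∉A a∈A t≼a with child-toward t≼a (λ t≡a → t∉A (subst (_∈ A) (sym t≡a) a∈A))
  ... | c , c≢r , pc≡t , c≼a with child-of-t-misses c≢r pc≡t
  ...   | b , b∈A , c⋠b with child-toward (All.lookup t≼A b∈A) (λ t≡b → t∉A (subst (_∈ A) (sym t≡b) b∈A))
  ...     | c′ , c′≢r , pc′≡t , c′≼b =
    degree-≥2 Span t c c′ (λ c≡c′ → c⋠b (subst (_≼ b) (sym c≡c′) c′≼b))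
      (child∈Span t∈Span c≢r pc≡t a∈A c≼a) (subst (λ p → adj G p c ≡ true) pc≡t (adj-par c c≢r))
      (child∈Span t∈Span c′≢r pc′≡t b∈A c′≼b) (subst (λ p → adj G p c′ ≡ true) pc′≡t (adj-par c′ c′≢r))
    where
      t∈Span : Span t ≡ true
      t∈Span = Span⁺ ≼-refl (lose a∈A t≼a)

  non-member-degree≥2 : ∀ x → Span x ≡ true → x ∉ A → 2 ≤ degIn G Span x
  non-member-degree≥2 x sx x∉A with find (proj₂ (Span⁻ sx)) | x Fin.≟ t
  ... | a , a∈A , x≼a | yes refl = top-degree≥2 x∉A a∈A x≼a
  ... | a , a∈A , x≼a | no  x≢t  = inner-degree≥2 sx x≢t a∈A x≼a (λ x≡a → x∉A (subst (_∈ A) (sym x≡a) a∈A))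

  -- So every leaf of the span lies in A.
  span-leaves : leafCount G Span ≤ length A
  span-leaves = unique⊆⇒length≤ (leaves Span) A (leaves-unique Span) leaf∈A
    where
      leaf∈A : ∀ {z} → z ∈ leaves Span → z ∈ A
      leaf∈A {z} z∈ with ∈-leaves⁻ Span z∈ | z ∈? A
      ... | _      , _     | yes z∈A = z∈A
      ... | z∈Span , deg≡1 | no  z∉A = ⊥-elim (<-irrefl refl (subst (2 ≤_) deg≡1 (non-member-degree≥2 z z∈Span z∉A)))

  span-separates : ∀ {w a b} → w ≢ root → a ∈ A → w ≼ a → b ∈ A → ¬ (w ≼ b) →
    Span w ≡ true × Span (par w) ≡ true
  span-separates {w} {a} {b} w≢r a∈A w≼a b∈A w⋠b with ≼-chain (All.lookup t≼A a∈A) w≼a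
  ... | inj₂ w≼t = ⊥-elim (w⋠b (≼-trans w≼t (All.lookup t≼A b∈A)))
  ... | inj₁ t≼w = Span⁺ t≼w (lose a∈A w≼a) ,
                   Span⁺ (proj₂ (≼-par⁻ t≼w (λ t≡w → w⋠b (subst (_≼ b) t≡w (All.lookup t≼A b∈A)))))
                         (lose a∈A (≼-trans (par≼ w≢r) w≼a))

module LeafOrder {n : ℕ} {G : Graph n} (T : RootedTree G) where
  open RootedTree T
  open Ancestry T

  IsChild : Fin n → Fin n → Set
  IsChild w c = c ≢ root × par c ≡ w

  child? : ∀ w c → Dec (IsChild w c)
  child? w c = ¬? (c Fin.≟ root) ×-dec (par c Fin.≟ w)

  children : Fin n → List (Fin n)
  children w = filter (child? w) (allFin n)

  ∈-children⁺ : ∀ {w c} → IsChild w c → c ∈ children w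
  ∈-children⁺ {w} {c} c-child = ∈-filter⁺ (child? w) (∈-allFin c) c-child

  ∈-children⁻ : ∀ {w c} → c ∈ children w → IsChild w c
  ∈-children⁻ {w} c∈ = proj₂ (∈-filter⁻ (child? w) {xs = allFin n} c∈)

  children-unique : ∀ w → Unique (children w)
  children-unique w = Unique.filter⁺ (child? w) (Unique.allFin⁺ n)

  child≼ : ∀ {w c} → IsChild w c → w ≼ c
  child≼ (c≢r , refl) = par≼ c≢r

  collect : (Fin n → List (Fin n)) → Fin n → List (Fin n) → List (Fin n)
  collect below w []         = [ w ]
  collect below w cs@(_ ∷ _) = concatMap below cs

  -- The childless descendants of w in depth-first order; the fuel f must
  -- exceed the height of w for the list to be complete (see Fuelled).
  leavesBelow : ℕ → Fin n → List (Fin n)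
  leavesBelow zero    w = []
  leavesBelow (suc f) w = collect (leavesBelow f) w (children w)

  leavesBelow-sound : ∀ f w {x} → x ∈ leavesBelow f w → w ≼ x × Childless x
  leavesBelow-sound (suc f) w {x} x∈ = go (children w) refl x∈
    where
      go : ∀ cs → children w ≡ cs → x ∈ collect (leavesBelow f) w cs → w ≼ x × Childless x
      go [] no-children (here refl) =
        ≼-refl , λ c c≢r pc≡x → case-[] (subst (c ∈_) no-children (∈-children⁺ (c≢r , pc≡x)))
        where
          case-[] : ∀ {c : Fin n} → c ∈ [] → ⊥
          case-[] ()
      go cs@(_ ∷ _) cs≡ x∈ with find (∈-concatMap⁻ (leavesBelow f) {xs = cs} x∈)
      ... | c , c∈cs , x∈c with leavesBelow-sound f c x∈c
      ...   | c≼x , childless = ≼-trans (child≼ (∈-children⁻ (subst (c ∈_) (sym cs≡) c∈cs))) c≼x , childless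

  -- Leaf lists of distinct siblings are disjoint, so no leaf is repeated.
  leavesBelow-unique : ∀ f w → Unique (leavesBelow f w)
  leavesBelow-unique zero    w = []
  leavesBelow-unique (suc f) w = go (children w) (children-unique w) ∈-children⁻
    where
      go-concat : ∀ cs → Unique cs → (∀ {c} → c ∈ cs → IsChild w c) → Unique (concatMap (leavesBelow f) cs)
      go-concat []       _            _ = []
      go-concat (c ∷ cs) (c∉cs ∷ cs!) children-of-w =
        Unique.++⁺ (leavesBelow-unique f c) (go-concat cs cs! (λ c∈ → children-of-w (there c∈))) disjoint
        where
          disjoint : ∀ {v} → ¬ (v ∈ leavesBelow f c × v ∈ concatMap (leavesBelow f) cs)
          disjoint (v∈c , v∈cs) with find (∈-concatMap⁻ (leavesBelow f) {xs = cs} v∈cs)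
          ... | c′ , c′∈cs , v∈c′ =
            let c≢r , pc≡w = children-of-w (here refl) ; c′≢r , pc′≡w = children-of-w (there c′∈cs) in
            All.lookup c∉cs c′∈cs (siblings-disjoint c≢r c′≢r (trans pc≡w (sym pc′≡w))
              (proj₁ (leavesBelow-sound f c v∈c)) (proj₁ (leavesBelow-sound f c′ v∈c′)))
      go : ∀ cs → Unique cs → (∀ {c} → c ∈ cs → IsChild w c) → Unique (collect (leavesBelow f) w cs)
      go []         _   _            = [] ∷ []
      go cs@(_ ∷ _) cs! children-of-w = go-concat cs cs! children-of-w

  -- Fuel f suffices below w when it exceeds the height of every vertex below w.
  Fuelled : ℕ → Fin n → Set
  Fuelled f w = bound ≤ f + depth w

  fuelled-suc : ∀ {f w} → Fuelled f w → ∃[ f′ ] (f ≡ suc f′)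
  fuelled-suc {zero}  {w} h = ⊥-elim (<-irrefl refl (≤-<-trans h (depth<bound w)))
  fuelled-suc {suc f}     _ = f , refl

  fuelled-child : ∀ {f w c} → Fuelled (suc f) w → IsChild w c → Fuelled f c
  fuelled-child {f} {c = c} h (c≢r , refl) =
    ≤-trans h (subst (_≤ f + depth c) (+-suc f (depth (par c))) (+-monoʳ-≤ f (depth-par c c≢r)))

  leavesBelow-nonempty : ∀ f w → Fuelled f w → ∃[ x ] x ∈ leavesBelow f w
  leavesBelow-nonempty f w h with fuelled-suc h
  ... | f′ , refl = go (children w) refl
    where
      go : ∀ cs → children w ≡ cs → ∃[ x ] x ∈ collect (leavesBelow f′) w cs
      go []       _   = w , here refl
      go (c ∷ cs) cs≡ with leavesBelow-nonempty f′ c (fuelled-child h (∈-children⁻ (subst (c ∈_) (sym cs≡) (here refl))))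
      ... | x , x∈ = x , ∈-++⁺ˡ x∈

  Block : Fin n → List (Fin n) → List (Fin n) → Set
  Block w xs ys = ∃[ P ] ∃[ Q ] (xs ≡ P ++ ys ++ Q × All (λ x → ¬ (w ≼ x)) P × All (λ x → ¬ (w ≼ x)) Q)

  collect-split : ∀ below w C₁ c C₂ →
    collect below w (C₁ ++ c ∷ C₂) ≡ concatMap below C₁ ++ below c ++ concatMap below C₂
  collect-split below w []       c C₂ = refl
  collect-split below w (x ∷ C₁) c C₂ = concatMap-++ below (x ∷ C₁) (c ∷ C₂)

  siblings-leaves : ∀ f {w} C → w ≢ root → (∀ {c} → c ∈ C → IsChild (par w) c) → w ∉ C →
    All (λ x → ¬ (w ≼ x)) (concatMap (leavesBelow f) C)
  siblings-leaves f {w} C w≢r siblings w∉C = All.tabulate λ x∈ w≼x →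
    let c , c∈C , x∈c = find (∈-concatMap⁻ (leavesBelow f) {xs = C} x∈)
        c≢r , pc≡pw = siblings c∈C
    in w∉C (subst (_∈ C) (siblings-disjoint c≢r w≢r pc≡pw (proj₁ (leavesBelow-sound f c x∈c)) w≼x) c∈C)

  block-step : ∀ f {w} → w ≢ root → Block w (leavesBelow (suc f) (par w)) (leavesBelow f w)
  block-step f {w} w≢r with ∈-∃++ (∈-children⁺ (w≢r , refl))
  ... | C₁ , C₂ , children≡ =
    concatMap (leavesBelow f) C₁ , concatMap (leavesBelow f) C₂ ,
    trans (cong (collect (leavesBelow f) (par w)) children≡) (collect-split (leavesBelow f) (par w) C₁ w C₂) ,
    siblings-leaves f C₁ w≢r (λ c∈ → ∈-children⁻ (subst (_ ∈_) (sym children≡) (∈-++⁺ˡ c∈))) (proj₁ w∉) ,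
    siblings-leaves f C₂ w≢r (λ c∈ → ∈-children⁻ (subst (_ ∈_) (sym children≡) (∈-++⁺ʳ C₁ (there c∈))))
      (proj₂ w∉)
    where
      w∉ : w ∉ C₁ × w ∉ C₂
      w∉ = unique-middle C₁ (subst Unique children≡ (children-unique (par w)))

  -- Blocks compose: non-descendants of par w are non-descendants of w.
  block-trans : ∀ {w xs ys zs} → w ≢ root → Block (par w) xs ys → Block w ys zs → Block w xs zs
  block-trans {w} {xs} {ys} {zs} w≢r (P , Q , xs≡ , P⋡ , Q⋡) (P′ , Q′ , ys≡ , P′⋡ , Q′⋡) =
    P ++ P′ , Q′ ++ Q , xs≡′ , All.++⁺ (All.map not-below P⋡) P′⋡ , All.++⁺ Q′⋡ (All.map not-below Q⋡)
    where
      not-below : ∀ {x} → ¬ (par w ≼ x) → ¬ (w ≼ x)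
      not-below pw⋠x w≼x = pw⋠x (≼-trans (par≼ w≢r) w≼x)
      xs≡′ : xs ≡ (P ++ P′) ++ zs ++ (Q′ ++ Q)
      xs≡′ = begin
        xs                          ≡⟨ xs≡ ⟩
        P ++ ys ++ Q                ≡⟨ cong (λ l → P ++ l ++ Q) ys≡ ⟩
        P ++ (P′ ++ zs ++ Q′) ++ Q  ≡⟨ cong (P ++_) (++-assoc P′ (zs ++ Q′) Q) ⟩
        P ++ P′ ++ (zs ++ Q′) ++ Q  ≡⟨ cong (λ l → P ++ P′ ++ l) (++-assoc zs Q′ Q) ⟩
        P ++ P′ ++ zs ++ Q′ ++ Q    ≡⟨ ++-assoc P P′ (zs ++ Q′ ++ Q) ⟨
        (P ++ P′) ++ zs ++ Q′ ++ Q  ∎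
        where open ≡-Reasoning

  leavesBelow-block : ∀ {f u w} → u ≼ w → Fuelled f u →
    ∃[ f′ ] (Fuelled f′ w × Block w (leavesBelow f u) (leavesBelow f′ w))
  leavesBelow-block {f} ≼-refl h = f , h , [] , [] , sym (++-identityʳ _) , [] , []
  leavesBelow-block (≼-par w≢r u≼pw) h with leavesBelow-block u≼pw h
  ... | f″ , h″ , blk with fuelled-suc h″
  ...   | f′ , refl = f′ , fuelled-child h″ (w≢r , refl) , block-trans w≢r blk (block-step f′ w≢r)

-- Positions 0, …, kd−1 fall into k classes {j, j+k, …, j+(d−1)k}, j < k.
-- A class splits the interval [a, b) if it has a member inside and one outside.
Splits : (d k a b : ℕ) → Set
Splits d k a b = ∃[ j ] ∃[ s ] ∃[ s′ ]
  (j < k × s < d × s′ < d × a ≤ j + s * k × j + s * k < b × (j + s′ * k < a ⊎ b ≤ j + s′ * k))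

-- For d ≥ 2, every interval [a, b) with 0 < a < b ≤ kd is split by some
-- class: by class 0 if it contains a multiple of k (0 itself lies outside),
-- and otherwise by the class of a, whose next member lies at or beyond b or
-- whose previous member lies before a.
interval-split : ∀ d k a b → 2 ≤ d → 1 ≤ a → a < b → b ≤ k * d → Splits d k a b
interval-split d zero      a b _ _ a<b b≤0 = ⊥-elim (<-irrefl refl (<-≤-trans (≤-<-trans z≤n a<b) b≤0))
interval-split d k@(suc _) a b d≥2 a≥1 a<b b≤kd = by-division (a % k) (a / k) (m≡m%n+[m/n]*n a k) (m%n<n a k)
  where
    within : ∀ q → q * k < b → q < d
    within q qk<b = *-cancelʳ-< k q d (<-≤-trans qk<b (subst (b ≤_) (*-comm k d) b≤kd))

    multiple-inside : ∀ q → a ≤ q * k → q * k < b → Splits d k a b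
    multiple-inside q a≤qk qk<b = 0 , q , 0 , s≤s z≤n , within q qk<b , ≤-trans (s≤s z≤n) d≥2 , a≤qk , qk<b , inj₁ a≥1

    by-division : ∀ j q → a ≡ j + q * k → j < k → Splits d k a b
    by-division zero    q a≡qk _ = multiple-inside q (≤-reflexive a≡qk) (subst (_< b) a≡qk a<b)
    by-division (suc j) q a≡ j<k with suc q * k <? b
    ... | yes [q+1]k<b = multiple-inside (suc q) (subst (_≤ k + q * k) (sym a≡) (+-monoˡ-≤ (q * k) (<⇒≤ j<k))) [q+1]k<b
    ... | no  [q+1]k≮b with q
    ...   | zero    = suc j , 0 , 1 , j<k , ≤-trans (s≤s z≤n) d≥2 , d≥2 , ≤-reflexive a≡ , subst (_< b) a≡ a<b ,
                      inj₂ (≤-trans (≮⇒≥ [q+1]k≮b) (m≤n+m (k + 0) (suc j)))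
    ...   | suc q′  = suc j , suc q′ , q′ , j<k , q<d , <⇒≤ q<d , ≤-reflexive a≡ , subst (_< b) a≡ a<b ,
                      inj₁ (subst (suc j + q′ * k <_) (sym a≡) (+-monoʳ-< (suc j) (m<n+m (q′ * k) {k} (s≤s z≤n))))
      where
        q<d : suc q′ < d
        q<d = within (suc q′) (≤-<-trans (m≤n+m (suc q′ * k) (suc j)) (subst (_< b) a≡ a<b))

nth : ∀ {A : Set} → List A → A → ℕ → A
nth []       y₀ i       = y₀
nth (x ∷ xs) y₀ zero    = x
nth (x ∷ xs) y₀ (suc i) = nth xs y₀ i

nth-all : ∀ {A : Set} {Pr : A → Set} xs (y₀ : A) → All Pr xs → Pr y₀ → ∀ i → Pr (nth xs y₀ i)
nth-all []       y₀ _          pr₀ i       = pr₀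
nth-all (x ∷ xs) y₀ (prx ∷ _)  pr₀ zero    = prx
nth-all (x ∷ xs) y₀ (_ ∷ prxs) pr₀ (suc i) = nth-all xs y₀ prxs pr₀ i

nth-in-block : ∀ {A : Set} {Pr : A → Set} X B Q (y₀ : A) → All Pr B →
  ∀ i → length X ≤ i → i < length X + length B → Pr (nth (X ++ B ++ Q) y₀ i)
nth-in-block (x ∷ X) B Q y₀ prB (suc i) (s≤s X≤i) (s≤s i<XB) = nth-in-block X B Q y₀ prB i X≤i i<XB
nth-in-block []      (b ∷ B) Q y₀ (prb ∷ prB) zero    _ _           = prb
nth-in-block []      (b ∷ B) Q y₀ (prb ∷ prB) (suc i) _ (s≤s i<B)   = nth-in-block [] B Q y₀ prB i z≤n i<B

nth-off-block : ∀ {A : Set} {Pr : A → Set} X B Q (y₀ : A) → All Pr X → All Pr Q → Pr y₀ →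
  ∀ i → i < length X ⊎ length X + length B ≤ i → Pr (nth (X ++ B ++ Q) y₀ i)
nth-off-block (x ∷ X) B Q y₀ (prx ∷ _) _ _ zero _ = prx
nth-off-block (x ∷ X) B Q y₀ (_ ∷ prX) prQ pr₀ (suc i) off =
  nth-off-block X B Q y₀ prX prQ pr₀ i (⊎-map ≤-pred ≤-pred off)
nth-off-block [] (b ∷ B) Q y₀ [] prQ pr₀ (suc i) (inj₂ (s≤s B≤i)) = nth-off-block [] B Q y₀ [] prQ pr₀ i (inj₂ B≤i)
nth-off-block [] [] Q y₀ [] prQ pr₀ i _ = nth-all Q y₀ prQ pr₀ i

SmallCover : ∀ {n} → Graph n → (d : ℕ) → .{{NonZero d}} → Set
SmallCover {n} G d = Σ (List (VSet n)) λ Ss →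
  Covers G Ss × All (λ S → IsTree G S × leafCount G S ≤ d) Ss × length Ss ≡ ceilDiv (leafCount G full) d

module UpperBound {n : ℕ} (G : Graph n) (tree : IsTree G full) (d : ℕ) .{{_ : NonZero d}} (d≥2 : 2 ≤ d) where
  open Degrees G
  open Walks G using (no-loop)

  ℓ : ℕ
  ℓ = leafCount G full

  k : ℕ
  k = ceilDiv ℓ d

  -- A tree with a single vertex has neither edges nor leaves; the empty list covers it.
  single-vertex : ∀ r₀ → (∀ x → x ≡ r₀) → SmallCover G d
  single-vertex r₀ only-r₀ = [] , (λ u v uv → ⊥-elim (no-edge u v uv)) , [] , sym k≡0
    where
      no-edge : ∀ u v → adj G u v ≡ true → ⊥
      no-edge u v uv = no-loop (trans (only-r₀ u) (sym (only-r₀ v))) uv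
      no-leaf : ∀ {x} → x ∈ leaves full → ⊥
      no-leaf {x} x∈ with degree≥1⇒neighbour full x (≤-reflexive (sym (proj₂ (∈-leaves⁻ full x∈))))
      ... | y , _ , xy = no-edge x y xy
      ℓ≡0 : ℓ ≡ 0
      ℓ≡0 = ≤-antisym (unique⊆⇒length≤ (leaves full) [] (leaves-unique full) (⊥-elim ∘ no-leaf)) z≤n
      k≡0 : k ≡ 0
      k≡0 = begin
        ceilDiv ℓ d      ≡⟨ cong (λ m → ceilDiv m d) ℓ≡0 ⟩
        ceilDiv 0 d      ≡⟨ m<n⇒m/n≡0 (pred<d d) ⟩
        0                ∎
        where
          open ≡-Reasoning
          pred<d : ∀ d → .{{NonZero d}} → d ∸ 1 < d
          pred<d (suc d′) = n<1+n d′

  -- A tree with two distinct vertices can be rooted at a leaf, whose unique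
  -- neighbour is then its child: root it at r₀, pick a deepest vertex r₁ ≠ r₀
  -- (childless, so a leaf), and re-root at r₁.
  leaf-rooting : ∀ {x₀ r₀} → x₀ ≢ r₀ → Σ (RootedTree G) λ T →
    degIn G full (RootedTree.root T) ≡ 1 × ¬ Ancestry.Childless T (RootedTree.root T)
  leaf-rooting {x₀} {r₀} x₀≢r₀ with Ancestry.childless-exists (rootedAt G tree r₀) x₀≢r₀
  ... | r₁ , r₁≢r₀ , childless = T , Ancestry.childless-leaf T₀ r₁ r₁≢r₀ childless , root-has-child
    where
      T₀ T : RootedTree G
      T₀ = rootedAt G tree r₀
      T = rootedAt G tree r₁
      root-has-child : ¬ Ancestry.Childless T r₁
      root-has-child r₁-childless with Ancestry.child-toward T (Ancestry.root≼ T r₀) (λ r₁≡r₀ → r₁≢r₀ r₁≡r₀)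
      ... | c , c≢r₁ , pc≡r₁ , _ = r₁-childless c c≢r₁ pc≡r₁

  module LeafRooted (T : RootedTree G) (root-leaf : degIn G full (RootedTree.root T) ≡ 1)
                    (root-has-child : ¬ Ancestry.Childless T (RootedTree.root T)) where
    open RootedTree T
    open Ancestry T
    open LeafOrder T

    root-fuelled : Fuelled bound root
    root-fuelled = m≤m+n bound (depth root)

    -- All leaves of G in depth-first order, starting with the root.
    Λ : List (Fin n)
    Λ = root ∷ leavesBelow bound root

    Λ-unique : Unique Λ
    Λ-unique = root∉ ∷ leavesBelow-unique bound root
      where
        root∉ : All (root ≢_) (leavesBelow bound root)
        root∉ = All.tabulate λ x∈ root≡x →
          root-has-child (subst Childless (sym root≡x) (proj₂ (leavesBelow-sound bound root x∈)))

    Λ⊆leaves : ∀ {x} → x ∈ Λ → x ∈ leaves full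
    Λ⊆leaves (here refl) = ∈-leaves⁺ full refl root-leaf
    Λ⊆leaves {x} (there x∈) with leavesBelow-sound bound root x∈
    ... | _ , childless = ∈-leaves⁺ full refl (childless-leaf x (λ { refl → root-has-child childless }) childless)

    Λ-length : length Λ ≤ k * d
    Λ-length = ≤-trans (unique⊆⇒length≤ Λ (leaves full) Λ-unique Λ⊆leaves) (ceilDiv-covers ℓ d)

    -- Group j consists of the entries of Λ at positions j, j+k, …, j+(d−1)k
    -- (the root where a position is past the end).
    member : ℕ → ℕ → Fin n
    member j s = nth Λ root (j + s * k)

    group : ℕ → List (Fin n)
    group j = map (member j) (downFrom d)

    member∈group : ∀ j {s} → s < d → member j s ∈ group j
    member∈group j s<d = ∈-map⁺ (member j) (∈-downFrom⁺ s<d)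

    first∈group : ∀ j → member j 0 ∈ group j
    first∈group j = member∈group j (≤-trans (s≤s z≤n) d≥2)

    span : ℕ → VSet n
    span j = Spanning.Span tree T (group j) (first∈group j)

    cover : List (VSet n)
    cover = map span (downFrom k)

    Separates : ℕ → Fin n → Set
    Separates j w = ∃[ a ] ∃[ b ] (a ∈ group j × w ≼ a × b ∈ group j × ¬ (w ≼ b))

    -- If the entries of Λ below w are exactly those of a block B, then by
    -- interval-split some group separates w; position 0 (the root) lies
    -- before the block.
    block-separated : ∀ {w} → w ≢ root → ∀ P B Q → Λ ≡ (root ∷ P) ++ B ++ Q →
      All (λ x → ¬ (w ≼ x)) P → All (w ≼_) B → All (λ x → ¬ (w ≼ x)) Q → 1 ≤ length B →
      ∃[ j ] (j < k × Separates j w)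
    block-separated {w} w≢r P B Q Λ≡ P⋡ B≽ Q⋡ B≥1
      with interval-split d k (length X) (length X + length B) d≥2 (s≤s z≤n) X<X+B X+B≤kd
      where
        X : List (Fin n)
        X = root ∷ P
        X<X+B : length X < length X + length B
        X<X+B = subst (_≤ length X + length B) (+-comm (length X) 1) (+-monoʳ-≤ (length X) B≥1)
        X+B≤kd : length X + length B ≤ k * d
        X+B≤kd = ≤-trans (≤-trans (m≤m+n (length X + length B) (length Q)) (≤-reflexive (begin
          length X + length B + length Q   ≡⟨ +-assoc (length X) (length B) (length Q) ⟩
          length X + (length B + length Q) ≡⟨ cong (length X +_) (length-++ B) ⟨
          length X + length (B ++ Q)       ≡⟨ length-++ X ⟨
          length (X ++ B ++ Q)             ≡⟨ cong length Λ≡ ⟨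
          length Λ                         ∎))) Λ-length
          where open ≡-Reasoning
    ... | j , s , s′ , j<k , s<d , s′<d , X≤i , i<X+B , off =
      j , j<k , member j s , member j s′ , member∈group j s<d ,
      subst (λ L → w ≼ nth L root (j + s * k)) (sym Λ≡) (nth-in-block (root ∷ P) B Q root B≽ _ X≤i i<X+B) ,
      member∈group j s′<d ,
      subst (λ L → ¬ (w ≼ nth L root (j + s′ * k))) (sym Λ≡)
        (nth-off-block (root ∷ P) B Q root (w⋠root ∷ P⋡) Q⋡ w⋠root _ off)
      where
        w⋠root : ¬ (w ≼ root)
        w⋠root w≼r = w≢r (≼-root w≼r)

    separating-group : ∀ w → w ≢ root → ∃[ j ] (j < k × Separates j w)
    separating-group w w≢r with leavesBelow-block (root≼ w) root-fuelled
    ... | f′ , w-fuelled , P , Q , below≡ , P⋡ , Q⋡ =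
      block-separated w≢r P (leavesBelow f′ w) Q (cong (root ∷_) below≡) P⋡
        (All.tabulate (λ x∈ → proj₁ (leavesBelow-sound f′ w x∈))) Q⋡
        (∈-length (proj₂ (leavesBelow-nonempty f′ w w-fuelled)))

    parent-edge-covered : ∀ w → w ≢ root → Any (λ S → S w ≡ true × S (par w) ≡ true) cover
    parent-edge-covered w w≢r with separating-group w w≢r
    ... | j , j<k , a , b , a∈ , w≼a , b∈ , w⋠b =
      lose (∈-map⁺ span (∈-downFrom⁺ j<k))
           (Spanning.span-separates tree T (group j) (first∈group j) w≢r a∈ w≼a b∈ w⋠b)

    covers : Covers G cover
    covers u v uv with edges u v uv
    ... | inj₁ (v≢r , refl) = Any.map (λ (sv , su) → su , sv) (parent-edge-covered v v≢r)
    ... | inj₂ (u≢r , refl) = parent-edge-covered u u≢r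

    cover-small : All (λ S → IsTree G S × leafCount G S ≤ d) cover
    cover-small = All.map⁺ (All.universal (λ j → Spanning.span-tree tree T (group j) (first∈group j) ,
      subst (leafCount G (span j) ≤_) (trans (length-map (member j) (downFrom d)) (length-downFrom d))
        (Spanning.span-leaves tree T (group j) (first∈group j))) (downFrom k))

    smallCover : SmallCover G d
    smallCover = cover , covers , cover-small , trans (length-map span (downFrom k)) (length-downFrom k)

  r₀ : Fin n
  r₀ = proj₁ (proj₁ tree)

  smallCover : SmallCover G d
  smallCover with Fin.any? (λ x → ¬? (x Fin.≟ r₀))
  ... | yes (x₀ , x₀≢r₀) =
    let T , root-leaf , root-has-child = leaf-rooting x₀≢r₀ in LeafRooted.smallCover T root-leaf root-has-child
  ... | no  no-other     = single-vertex r₀ (λ x → decidable-stable (x Fin.≟ r₀) (λ x≢r₀ → no-other (x , x≢r₀)))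

mainTheorem8 : ∀ (d : ℕ) .{{_ : NonZero d}} → 2 ≤ d →
    ∀ {n : ℕ} (G : Graph n) → IsTree G full →
      (Σ (List (VSet n)) λ Ss →
          Covers G Ss
        × All (λ S → IsTree G S × leafCount G S ≤ d) Ss
        × length Ss ≡ ceilDiv (leafCount G full) d)
    × (∀ (Ss : List (VSet n)) → Covers G Ss →
          All (λ S → IsTree G S × leafCount G S ≤ d) Ss →
          ceilDiv (leafCount G full) d ≤ length Ss)
mainTheorem8 d d≥2 G tree = UpperBound.smallCover G tree d d≥2 , lower-bound
  where
    lower-bound : ∀ Ss → Covers G Ss → All (λ S → IsTree G S × leafCount G S ≤ d) Ss →
      ceilDiv (leafCount G full) d ≤ length Ss
    lower-bound Ss cover subtrees = ceilDiv-least (leafCount G full) (length Ss) d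
      (Degrees.leafCount≤cover-size*d G d Ss cover (All.map proj₂ subtrees))
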